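{- Let $k\ge 2$ and $p\in(0,1/2]$ be the parameter $p=\left(1-2^{ -2k/\alpha(n)}\right)^{1/k}$ (with $\alpha(n)=\omega(1)$ and $n$ large enough that $p\le1/2$). Let $\mathcal{P}_k$ be the probability distribution on $\{0,1\}^k$ defined by $\mathcal{P}_k(x)=p^m(1-p)^{k-m}-(-1)^{k-m}p^k$, where $m$ is the number of ones in $x$. Then for any $i\in[k]$, if $X=(X_1,\dots,X_k)\sim\mathcal{P}_k$, the $k-1$ bits $(X_\ell)_{\ell\ne i}$ are independent, each equal to $1$ with probability $p$.
   Context: $\mathcal{P}_k$ is the distribution of $(U_{1,s_1}[j],\dots,U_{k,s_k}[j])$ for a fixed coordinate $j$ in an instance obtained by planting: starting from $k$ independent bits each equal to $1$ with probability $p$, letting $m$ be the number of ones, and, if $k-m$ is even, flipping the last bit with probability $(p/(1-p))^{k-m}$. -}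

module Defs where

open import Level using (Level)
open import Algebra.Bundles using (CommutativeRing)
open import Data.Nat using (ℕ; zero; suc; _∸_)
open import Data.Bool using (Bool; true; false)
open import Data.Vec using (Vec; []; _∷_; insertAt)
open import Data.Fin using (Fin)

ones : ∀ {k} → Vec Bool k → ℕ
ones []           = 0
ones (true ∷ xs)  = suc (ones xs)
ones (false ∷ xs) = ones xs

module Dist {c ℓ : Level} (R : CommutativeRing c ℓ) where
  open CommutativeRing R

  pow : Carrier → ℕ → Carrier
  pow x zero    = 1#
  pow x (suc n) = x * pow x n

  Pk : (p : Carrier) → (k : ℕ) → Vec Bool k → Carrier
  Pk p k x = (pow p (ones x) * pow (1# - p) (k ∸ ones x))
             - (pow (- 1#) (k ∸ ones x) * pow p k)

  marginal : (p : Carrier) → (n : ℕ) → Fin (suc n) → Vec Bool n → Carrier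
  marginal p n i y = Pk p (suc n) (insertAt y i false) + Pk p (suc n) (insertAt y i true)

  bern : Carrier → Bool → Carrier
  bern p true  = p
  bern p false = 1# - p

  product : (p : Carrier) → ∀ {n} → Vec Bool n → Carrier
  product p []       = 1#
  product p (b ∷ bs) = bern p b * product p bs

{-# OPTIONS --safe #-}
module Submission where

-- P_k(x) depends on x only through its number of ones, so the marginal does not
-- depend on which bit is removed.  If the k - 1 remaining bits contain m ones and
-- j zeros, summing over the removed bit gives
--   p^m (1-p)^(j+1) + p^(m+1) (1-p)^j = p^m (1-p)^j,
-- while the correction terms (-1)^(j+1) p^k and (-1)^j p^k cancel.  This holds in
-- every commutative ring and for every p, and already for k = 1.

open import Defs
open import Level using (Level)
open import Algebra.Bundles using (CommutativeRing)
open import Data.Nat using (ℕ; suc; _≤_; _∸_; z≤n; s≤s)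
open import Data.Nat.Properties using (+-∸-assoc; m≤n⇒m≤1+n)
open import Data.Bool using (Bool; true; false)
open import Data.Vec using (Vec; []; _∷_; insertAt)
open import Data.Fin using (Fin; zero; suc)
open import Relation.Binary.PropositionalEquality using (_≡_; refl; cong)

ones≤length : ∀ {n} (y : Vec Bool n) → ones y ≤ n
ones≤length []          = z≤n
ones≤length (true ∷ y)  = s≤s (ones≤length y)
ones≤length (false ∷ y) = m≤n⇒m≤1+n (ones≤length y)

suc-∸-ones : ∀ {n} (y : Vec Bool n) → suc n ∸ ones y ≡ suc (n ∸ ones y)
suc-∸-ones y = +-∸-assoc 1 (ones≤length y)

ones-insertAt : ∀ {n} (y : Vec Bool n) (i : Fin (suc n)) (b : Bool) →
                ones (insertAt y i b) ≡ ones (b ∷ y)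
ones-insertAt y           zero    b     = refl
ones-insertAt (false ∷ y) (suc i) false = ones-insertAt y i false
ones-insertAt (false ∷ y) (suc i) true  = ones-insertAt y i true
ones-insertAt (true ∷ y)  (suc i) false = cong suc (ones-insertAt y i false)
ones-insertAt (true ∷ y)  (suc i) true  = cong suc (ones-insertAt y i true)

module _ {c ℓ : Level} (R : CommutativeRing c ℓ) where
  open CommutativeRing R hiding (zero; refl)
  open Dist R
  open import Algebra.Properties.Ring ring using (-1*x≈-x; -0#≈0#)
  open import Algebra.Properties.AbelianGroup +-abelianGroup using (⁻¹-∙-comm)
  open import Algebra.Properties.CommutativeSemigroup +-commutativeSemigroup
    using (interchange)
  open import Algebra.Properties.CommutativeSemigroup *-commutativeSemigroup
    using (x∙yz≈y∙xz)
  open import Relation.Binary.Reasoning.Setoid setoid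

  [1-p]*x+p*x≈x : ∀ p x → (1# - p) * x + p * x ≈ x
  [1-p]*x+p*x≈x p x = begin
    (1# - p) * x + p * x   ≈⟨ distribʳ x (1# - p) p ⟨
    ((1# - p) + p) * x     ≈⟨ *-congʳ (+-assoc 1# (- p) p) ⟩
    (1# + (- p + p)) * x   ≈⟨ *-congʳ (+-congˡ (-‿inverseˡ p)) ⟩
    (1# + 0#) * x          ≈⟨ *-congʳ (+-identityʳ 1#) ⟩
    1# * x                 ≈⟨ *-identityˡ x ⟩
    x                      ∎

  [-1*x]*y+x*y≈0 : ∀ x y → (- 1# * x) * y + x * y ≈ 0#
  [-1*x]*y+x*y≈0 x y = begin
    (- 1# * x) * y + x * y  ≈⟨ distribʳ y (- 1# * x) x ⟨
    (- 1# * x + x) * y      ≈⟨ *-congʳ (+-congʳ (-1*x≈-x x)) ⟩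
    (- x + x) * y           ≈⟨ *-congʳ (-‿inverseˡ x) ⟩
    0# * y                  ≈⟨ zeroˡ y ⟩
    0#                      ∎

  x-u+[y-v]≈x+y : ∀ {u v} x y → u + v ≈ 0# → (x - u) + (y - v) ≈ x + y
  x-u+[y-v]≈x+y {u} {v} x y u+v≈0 = begin
    (x - u) + (y - v)    ≈⟨ interchange x (- u) y (- v) ⟩
    (x + y) + (- u - v)  ≈⟨ +-congˡ (⁻¹-∙-comm u v) ⟩
    (x + y) - (u + v)    ≈⟨ +-congˡ (-‿cong u+v≈0) ⟩
    (x + y) - 0#         ≈⟨ +-congˡ -0#≈0# ⟩
    (x + y) + 0#         ≈⟨ +-identityʳ (x + y) ⟩
    x + y                ∎

  product≈pow-ones : ∀ p {n} (y : Vec Bool n) →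
                     product p y ≈ pow p (ones y) * pow (1# - p) (n ∸ ones y)
  product≈pow-ones p []          = sym (*-identityˡ 1#)
  product≈pow-ones p (true ∷ y)  =
    trans (*-congˡ (product≈pow-ones p y)) (sym (*-assoc p _ _))
  product≈pow-ones p {suc n} (false ∷ y) rewrite suc-∸-ones y =
    trans (*-congˡ (product≈pow-ones p y)) (x∙yz≈y∙xz (1# - p) _ _)

  marginal-zero≈product : ∀ p n (y : Vec Bool n) → marginal p n zero y ≈ product p y
  marginal-zero≈product p n y rewrite suc-∸-ones y = begin
    (a * (q * b) - (- 1# * e) * f) + ((p * a) * b - e * f)
      ≈⟨ x-u+[y-v]≈x+y _ _ ([-1*x]*y+x*y≈0 e f) ⟩
    a * (q * b) + (p * a) * b
      ≈⟨ +-cong (x∙yz≈y∙xz a q b) (*-assoc p a b) ⟩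
    q * (a * b) + p * (a * b)
      ≈⟨ [1-p]*x+p*x≈x p (a * b) ⟩
    a * b
      ≈⟨ product≈pow-ones p y ⟨
    product p y ∎
    where
    q = 1# - p
    a = pow p (ones y)
    b = pow q (n ∸ ones y)
    e = pow (- 1#) (n ∸ ones y)
    f = pow p (suc n)

  marginal-insertAt≡marginal-zero : ∀ p n (i : Fin (suc n)) (y : Vec Bool n) →
                                    marginal p n i y ≡ marginal p n zero y
  marginal-insertAt≡marginal-zero p n i y
    rewrite ones-insertAt y i false | ones-insertAt y i true = refl

lemma5 : ∀ {c ℓ : Level} (R : CommutativeRing c ℓ) (p : CommutativeRing.Carrier R)
         (n : ℕ) → 2 ≤ suc n → (i : Fin (suc n)) → (y : Vec Bool n) →
         CommutativeRing._≈_ R (Dist.marginal R p n i y) (Dist.product R p y)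
lemma5 R p n _ i y rewrite marginal-insertAt≡marginal-zero R p n i y =
  marginal-zero≈product R p n y
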